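{- For each odd prime $p$ there exists a quaternary orthogonal design $\mathrm{COD}(1+p^2;1,p^2)$.
   Context: Let $x_1,\dots,x_k$ be commuting real indeterminates. A quaternary orthogonal design $\mathrm{COD}(n;s_1,\dots,s_k)$ of order $n$ and type $(s_1,\dots,s_k)$ is an $n\times n$ matrix $D$ with entries from $\{0\}\cup\{\pm x_\ell,\pm i x_\ell : 1\le \ell\le k\}$ such that $DD^*=\big(\sum_{\ell=1}^k s_\ell x_\ell^2\big) I_n$, where $D^*$ denotes the conjugate transpose. -}

module Defs where

open import Data.Nat using (ℕ; zero; suc; _^_)
open import Data.Integer as ℤ using (ℤ; +_; 0ℤ; 1ℤ; -1ℤ)
open import Data.Fin using (Fin; zero; suc; _≟_)
open import Relation.Nullary using (yes; no)
open import Relation.Binary.PropositionalEquality using (_≡_; _≢_)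

record ℤ[i] : Set where
  constructor _+i_
  field
    re : ℤ
    im : ℤ
open ℤ[i] public

0ᵍ : ℤ[i]
0ᵍ = 0ℤ +i 0ℤ

_+ᵍ_ : ℤ[i] → ℤ[i] → ℤ[i]
(a +i b) +ᵍ (c +i d) = (a ℤ.+ c) +i (b ℤ.+ d)

_*ᵍ_ : ℤ[i] → ℤ[i] → ℤ[i]
(a +i b) *ᵍ (c +i d) = ((a ℤ.* c) ℤ.- (b ℤ.* d)) +i ((a ℤ.* d) ℤ.+ (b ℤ.* c))

conjᵍ : ℤ[i] → ℤ[i]
conjᵍ (a +i b) = a +i (ℤ.- b)

fromℕᵍ : ℕ → ℤ[i]
fromℕᵍ n = (+ n) +i 0ℤ

data Unit4 : Set where
  u1 ui um1 umi : Unit4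

unitVal : Unit4 → ℤ[i]
unitVal u1  = 1ℤ +i 0ℤ
unitVal ui  = 0ℤ +i 1ℤ
unitVal um1 = -1ℤ +i 0ℤ
unitVal umi = 0ℤ +i -1ℤ

-- an entry of a quaternary design in indeterminates x_0..x_{k-1}:
-- either 0, or u·x_ℓ with u ∈ {1, i, -1, -i}
data Entry (k : ℕ) : Set where
  zeroE : Entry k
  var   : Unit4 → Fin k → Entry k

Matrix : ℕ → ℕ → Set
Matrix n k = Fin n → Fin n → Entry k

Σᵍ : (n : ℕ) → (Fin n → ℤ[i]) → ℤ[i]
Σᵍ zero    f = 0ᵍ
Σᵍ (suc n) f = f zero +ᵍ Σᵍ n (λ j → f (suc j))

-- coefficient of the ordered product x_ℓ · x_m in  e · conj(e')
prodCoeff : ∀ {k} → Entry k → Entry k → Fin k → Fin k → ℤ[i]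
prodCoeff zeroE      _          ℓ m = 0ᵍ
prodCoeff (var _ _)  zeroE      ℓ m = 0ᵍ
prodCoeff (var u ℓ′) (var v m′) ℓ m with ℓ′ ≟ ℓ | m′ ≟ m
... | yes _ | yes _ = unitVal u *ᵍ conjᵍ (unitVal v)
... | _     | _     = 0ᵍ

-- ordered coefficient of x_ℓ x_m in the (a,b) entry of D D*
C : ∀ {n k} → Matrix n k → Fin n → Fin n → Fin k → Fin k → ℤ[i]
C {n} D a b ℓ m = Σᵍ n (λ c → prodCoeff (D a c) (D b c) ℓ m)

δ : ∀ {n} → Fin n → Fin n → ℕ → ℤ[i]
δ a b s with a ≟ b
... | yes _ = fromℕᵍ s
... | no  _ = 0ᵍ

-- D D* = (Σ_ℓ s_ℓ x_ℓ²) I_n as an identity of polynomials in the commuting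
-- indeterminates x_ℓ with ℤ[i] coefficients: the coefficient of x_ℓ² in
-- (D D*)_{ab} is s_ℓ δ_{ab}, and the coefficient of x_ℓ x_m (ℓ ≠ m), which
-- collects both ordered products, is 0.
IsCOD : (n k : ℕ) → (Fin k → ℕ) → Matrix n k → Set
IsCOD n k s D =
  (∀ a b ℓ → C D a b ℓ ℓ ≡ δ a b (s ℓ)) ×′
  (∀ a b ℓ m → ℓ ≢ m → C D a b ℓ m +ᵍ C D a b m ℓ ≡ 0ᵍ)
  where
  open import Data.Product using () renaming (_×_ to _×′_)

COD : (n k : ℕ) → (Fin k → ℕ) → Set
COD n k s = Σ′ (Matrix n k) (IsCOD n k s)
  where open import Data.Product using () renaming (Σ to Σ′)

type1p² : ℕ → Fin 2 → ℕ
type1p² p zero    = 1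
type1p² p (suc _) = p ^ 2

-- D = x₀ I + i x₁ S is a COD(n; 1, k) whenever S is a symmetric conference matrix with S Sᵀ = k I:
-- the cross terms i x₀ x₁ (S - Sᵀ) cancel by symmetry and the x₁² part is S Sᵀ.  A symmetric
-- conference matrix of order p² + 1 is the bordering [[0, 1ᵀ], [1, M]] of a core M on the points
-- of the affine plane AG(2, p): M x y = c L for the unique parallel class L containing the line
-- through x and y, with weights c L = ±1 summing to zero (possible as p + 1 is even).  Lines of
-- one class partition the plane into lines of p points and lines of different classes meet in
-- exactly one point; counting incidences with these two facts gives M 1 = 0 and M Mᵀ = p² I - J.
module Submission where

open import Defs
open import Data.Nat using (ℕ; suc; _^_)
open import Data.Nat.Divisibility using (_∣_)
open import Data.Nat.Primality using (Prime)
open import Relation.Nullary using (¬_)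

open import Data.Empty using (⊥-elim)
open import Data.Fin as Fin using (Fin; zero; suc; toℕ; fromℕ<; _≟_; _↑ˡ_; _↑ʳ_; combine; remQuot; cast; punchIn)
import Data.Fin.Properties as Fin
open import Data.Integer as ℤ using (ℤ; +_; -[1+_]; 0ℤ; 1ℤ; -1ℤ; _+_; _*_; -_; _-_; ∣_∣)
import Data.Integer.DivMod as ℤ
open import Data.Integer.Divisibility.Signed
  using (divides; ∣m⇒∣-m; ∣m∣n⇒∣m+n; ∣n⇒∣m*n; ∣ᵤ⇒∣; ∣⇒∣ᵤ) renaming (_∣_ to _∣ℤ_; _∣?_ to _∣ℤ?_)
import Data.Integer.Properties as ℤ
open import Data.Integer.Tactic.RingSolver using (solve-∀)
open import Data.Nat as ℕ using (zero; NonZero)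
open import Data.Nat.Coprimality using (Coprime; coprime-Bézout)
import Data.Nat.Divisibility as ℕ
open import Data.Nat.GCD using (module Bézout)
open import Data.Nat.Primality using (prime⇒nonZero; prime⇒irreducible)
import Data.Nat.Properties as ℕ
open import Data.Product using (_×_; _,_; ∃; ∃!; uncurry; proj₁; proj₂)
open import Data.Sum using (_⊎_; inj₁; inj₂)
open import Function using (_∘_)
open import Relation.Binary using (IsDecEquivalence)
import Relation.Binary.Construct.On as On
open import Relation.Binary.PropositionalEquality
  using (_≡_; _≢_; refl; sym; trans; cong; cong₂; subst; module ≡-Reasoning)
open import Relation.Nullary using (Dec; yes; no; contradiction)
open import Algebra.Properties.Semiring.Sum ℤ.+-*-semiring
  using (sum; sum-syntax; sum-cong-≗; sum-remove; sum-replicate-zero; ∑-distrib-+; ∑-comm;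
         *-distribˡ-sum; *-distribʳ-sum)

open ≡-Reasoning

-- Finite sums over ℤ and indicators

sum-const : ∀ n x → ∑[ i < n ] x ≡ + n * x
sum-const zero    x = refl
sum-const (suc n) x = trans (cong (_+_ x) (sum-const n x)) (sym (ℤ.suc-* (+ n) x))

sum-zero : ∀ {n} {f : Fin n → ℤ} → (∀ i → f i ≡ 0ℤ) → sum f ≡ 0ℤ
sum-zero {n} f≡0 = trans (sum-cong-≗ f≡0) (sum-replicate-zero n)

sum-single : ∀ {n} (f : Fin n → ℤ) i → (∀ j → j ≢ i → f j ≡ 0ℤ) → sum f ≡ f i
sum-single {suc n} f i f≡0 = begin
  sum f                     ≡⟨ sum-remove {i = i} f ⟩
  f i + sum (f ∘ punchIn i) ≡⟨ cong (_+_ (f i)) (sum-zero (λ j → f≡0 _ (Fin.punchInᵢ≢i i j))) ⟩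
  f i + 0ℤ                  ≡⟨ ℤ.+-identityʳ (f i) ⟩
  f i                       ∎

sum-*-sum : ∀ {m n} (f : Fin m → ℤ) (g : Fin n → ℤ) →
            sum f * sum g ≡ ∑[ i < m ] ∑[ j < n ] (f i * g j)
sum-*-sum f g = trans (*-distribʳ-sum (sum g) f) (sum-cong-≗ (λ i → *-distribˡ-sum (f i) g))

sum-↑ : ∀ m {n} (f : Fin (m ℕ.+ n) → ℤ) → sum f ≡ sum (f ∘ (_↑ˡ n)) + sum (f ∘ (m ↑ʳ_))
sum-↑ zero        f = sym (ℤ.+-identityˡ _)
sum-↑ (suc m) {n} f = trans (cong (_+_ (f zero)) (sum-↑ m (f ∘ suc)))
  (sym (ℤ.+-assoc (f zero) (sum (f ∘ suc ∘ (_↑ˡ n))) (sum (f ∘ suc ∘ (m ↑ʳ_)))))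

sum-combine : ∀ m {n} (f : Fin (m ℕ.* n) → ℤ) → sum f ≡ ∑[ i < m ] ∑[ j < n ] f (combine i j)
sum-combine zero        f = refl
sum-combine (suc m) {n} f =
  trans (sum-↑ n f) (cong (_+_ (sum (f ∘ (_↑ˡ m ℕ.* n)))) (sum-combine m (f ∘ (n ↑ʳ_))))

sum-cast : ∀ {m n} (m≡n : m ≡ n) (f : Fin n → ℤ) → sum (f ∘ cast m≡n) ≡ sum f
sum-cast refl f = sum-cong-≗ (cong f ∘ Fin.cast-is-id refl)

Σᵍ-split : ∀ n {f : Fin n → ℤ[i]} {g h : Fin n → ℤ} → (∀ i → f i ≡ g i +i h i) →
           Σᵍ n f ≡ sum g +i sum h
Σᵍ-split zero    f≡ = refl
Σᵍ-split (suc n) f≡ rewrite f≡ zero | Σᵍ-split n (f≡ ∘ suc) = refl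

𝟙 : ∀ {a} {A : Set a} → Dec A → ℤ
𝟙 (yes _) = 1ℤ
𝟙 (no  _) = 0ℤ

𝟙-yes : ∀ {a} {A : Set a} (A? : Dec A) → A → 𝟙 A? ≡ 1ℤ
𝟙-yes (yes _) _ = refl
𝟙-yes (no ¬a) a = ⊥-elim (¬a a)

𝟙-no : ∀ {a} {A : Set a} (A? : Dec A) → ¬ A → 𝟙 A? ≡ 0ℤ
𝟙-no (yes a) ¬a = ⊥-elim (¬a a)
𝟙-no (no _)  _  = refl

𝟙-cong : ∀ {a b} {A : Set a} {B : Set b} (A? : Dec A) (B? : Dec B) → (A → B) → (B → A) → 𝟙 A? ≡ 𝟙 B?
𝟙-cong (yes _) (yes _) _   _   = refl
𝟙-cong (yes a) (no ¬b) A→B _   = ⊥-elim (¬b (A→B a))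
𝟙-cong (no ¬a) (yes b) _   B→A = ⊥-elim (¬a (B→A b))
𝟙-cong (no _)  (no _)  _   _   = refl

sum-𝟙-∃! : ∀ {n p} {P : Fin n → Set p} (P? : ∀ i → Dec (P i)) → ∃! _≡_ P → ∑[ i < n ] 𝟙 (P? i) ≡ 1ℤ
sum-𝟙-∃! P? (i , Pi , unique) =
  trans (sum-single _ i (λ j j≢i → 𝟙-no (P? j) (λ Pj → j≢i (sym (unique Pj))))) (𝟙-yes (P? i) Pi)

sum-𝟙-≡-* : ∀ {n} (a : Fin n) (f : Fin n → ℤ) → ∑[ c < n ] (𝟙 (a ≟ c) * f c) ≡ f a
sum-𝟙-≡-* {n} a f = begin
  ∑[ c < n ] (𝟙 (a ≟ c) * f c) ≡⟨ sum-single _ a (λ c c≢a → cong (_* f c) (𝟙-no (a ≟ c) (c≢a ∘ sym))) ⟩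
  𝟙 (a ≟ a) * f a              ≡⟨ cong (_* f a) (𝟙-yes (a ≟ a) refl) ⟩
  1ℤ * f a                     ≡⟨ ℤ.*-identityˡ (f a) ⟩
  f a                          ∎

module _ {a ℓ} {A : Set a} {_∼_ : A → A → Set ℓ} (∼-isDecEquivalence : IsDecEquivalence _∼_) where
  open IsDecEquivalence ∼-isDecEquivalence using ()
    renaming (_≟_ to _∼?_; sym to ∼-sym; trans to ∼-trans)

  𝟙-sym : ∀ x y → 𝟙 (x ∼? y) ≡ 𝟙 (y ∼? x)
  𝟙-sym x y = 𝟙-cong (x ∼? y) (y ∼? x) ∼-sym ∼-sym

  𝟙-product : ∀ x y z → 𝟙 (x ∼? z) * 𝟙 (y ∼? z) ≡ 𝟙 (x ∼? y) * 𝟙 (x ∼? z)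
  𝟙-product x y z with x ∼? z | y ∼? z
  ... | yes x∼z | yes y∼z rewrite 𝟙-yes (x ∼? y) (∼-trans x∼z (∼-sym y∼z)) = refl
  ... | yes x∼z | no  y≁z rewrite 𝟙-no (x ∼? y) (λ x∼y → y≁z (∼-trans (∼-sym x∼y) x∼z)) = refl
  ... | no  _   | _       = sym (ℤ.*-zeroʳ (𝟙 (x ∼? y)))

  sum-𝟙-product : ∀ {n} x y (f : Fin n → A) →
                  ∑[ i < n ] (𝟙 (x ∼? f i) * 𝟙 (y ∼? f i)) ≡ 𝟙 (x ∼? y) * ∑[ i < n ] 𝟙 (x ∼? f i)
  sum-𝟙-product x y f =
    trans (sum-cong-≗ (λ i → 𝟙-product x y (f i))) (sym (*-distribˡ-sum (𝟙 (x ∼? y)) (λ i → 𝟙 (x ∼? f i))))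

-- Signs and symmetric conference matrices

IsSign : ℤ → Set
IsSign x = x ≡ 1ℤ ⊎ x ≡ -1ℤ

sign*sign : ∀ {x} → IsSign x → x * x ≡ 1ℤ
sign*sign (inj₁ refl) = refl
sign*sign (inj₂ refl) = refl

-1^-sign : ∀ n → IsSign (-1ℤ ℤ.^ n)
-1^-sign zero    = inj₁ refl
-1^-sign (suc n) with -1^-sign n
... | inj₁ e = inj₂ (cong (-1ℤ *_) e)
... | inj₂ e = inj₁ (cong (-1ℤ *_) e)

sum-alternating-odd : ∀ n → ¬ 2 ∣ n → ∑[ i < suc n ] (-1ℤ ℤ.^ toℕ i) ≡ 0ℤ
sum-alternating-odd zero          2∤n = ⊥-elim (2∤n (2 ℕ.∣0))
sum-alternating-odd (suc zero)    _   = refl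
sum-alternating-odd (suc (suc n)) 2∤n = cong (λ t → 1ℤ + (-1ℤ + t)) (begin
  ∑[ i < suc n ] (-1ℤ * (-1ℤ * -1ℤ ℤ.^ toℕ i)) ≡⟨ sum-cong-≗ {suc n} (λ i → -1*-1* (-1ℤ ℤ.^ toℕ i)) ⟩
  ∑[ i < suc n ] (-1ℤ ℤ.^ toℕ i)              ≡⟨ sum-alternating-odd n (2∤n ∘ ℕ.∣m∣n⇒∣m+n (ℕ.∣-refl {2})) ⟩
  0ℤ                                           ∎)
  where
  -1*-1* : ∀ x → -1ℤ * (-1ℤ * x) ≡ x
  -1*-1* = solve-∀

record IsSeidelMatrix {n} (S : Fin n → Fin n → ℤ) : Set where
  field
    symmetric         : ∀ a b → S a b ≡ S b a
    hollow            : ∀ a → S a a ≡ 0ℤ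
    off-diagonal-sign : ∀ {a b} → a ≢ b → IsSign (S a b)

-- The entries force k = n - 1; keeping k avoids truncated subtraction.
record IsSymmetricConference (n k : ℕ) (S : Fin n → Fin n → ℤ) : Set where
  field
    isSeidelMatrix : IsSeidelMatrix S
    gram           : ∀ a b → ∑[ c < n ] (S a c * S b c) ≡ + k * 𝟙 (a ≟ b)

x₀ x₁ : Fin 2
x₀ = zero
x₁ = suc zero

iSign : ℤ → Unit4
iSign (+ _)    = ui
iSign -[1+ _ ] = umi

conferenceEntry : ∀ {A : Set} → Dec A → ℤ → Entry 2
conferenceEntry (yes _) _ = var u1 x₀
conferenceEntry (no _)  s = var (iSign s) x₁

iSign-coeff₁₁ : ∀ {s t} → IsSign s → IsSign t →
                prodCoeff (var (iSign s) x₁) (var (iSign t) x₁) x₁ x₁ ≡ (s * t) +i 0ℤ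
iSign-coeff₁₁ (inj₁ refl) (inj₁ refl) = refl
iSign-coeff₁₁ (inj₁ refl) (inj₂ refl) = refl
iSign-coeff₁₁ (inj₂ refl) (inj₁ refl) = refl
iSign-coeff₁₁ (inj₂ refl) (inj₂ refl) = refl

iSign-coeff₀₁ : ∀ {t} → IsSign t → prodCoeff (var u1 x₀) (var (iSign t) x₁) x₀ x₁ ≡ 0ℤ +i (1ℤ * - t)
iSign-coeff₀₁ (inj₁ refl) = refl
iSign-coeff₀₁ (inj₂ refl) = refl

iSign-coeff₁₀ : ∀ {s} → IsSign s → prodCoeff (var (iSign s) x₁) (var u1 x₀) x₁ x₀ ≡ 0ℤ +i (1ℤ * s)
iSign-coeff₁₀ (inj₁ refl) = refl
iSign-coeff₁₀ (inj₂ refl) = refl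

δ≡𝟙 : ∀ {n} (a b : Fin n) s → δ a b s ≡ (+ s * 𝟙 (a ≟ b)) +i 0ℤ
δ≡𝟙 a b s with a ≟ b
... | yes _ = cong (_+i 0ℤ) (sym (ℤ.*-identityʳ (+ s)))
... | no  _ = cong (_+i 0ℤ) (sym (ℤ.*-zeroʳ (+ s)))

module ConferenceDesign {n k} {S : Fin n → Fin n → ℤ} (conference : IsSymmetricConference n k S) where
  open IsSymmetricConference conference
  open IsSeidelMatrix isSeidelMatrix

  D : Matrix n 2
  D a b = conferenceEntry (a ≟ b) (S a b)

  product-coeff₀₀ : ∀ a b c → prodCoeff (D a c) (D b c) x₀ x₀ ≡ (𝟙 (a ≟ c) * 𝟙 (b ≟ c)) +i 0ℤ
  product-coeff₀₀ a b c with a ≟ c | b ≟ c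
  ... | yes _ | yes _ = refl
  ... | yes _ | no  _ = refl
  ... | no  _ | yes _ = refl
  ... | no  _ | no  _ = refl

  product-coeff₁₁ : ∀ a b c → prodCoeff (D a c) (D b c) x₁ x₁ ≡ (S a c * S b c) +i 0ℤ
  product-coeff₁₁ a b c with a ≟ c | b ≟ c
  ... | yes refl | yes _    rewrite hollow a = refl
  ... | yes refl | no  _    rewrite hollow a = refl
  ... | no  _    | yes refl rewrite hollow b = cong (_+i 0ℤ) (sym (ℤ.*-zeroʳ (S a b)))
  ... | no  a≢c  | no  b≢c  = iSign-coeff₁₁ (off-diagonal-sign a≢c) (off-diagonal-sign b≢c)

  product-coeff₀₁ : ∀ a b c → prodCoeff (D a c) (D b c) x₀ x₁ ≡ 0ℤ +i (𝟙 (a ≟ c) * - S b c)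
  product-coeff₀₁ a b c with a ≟ c | b ≟ c
  ... | yes refl | yes refl rewrite hollow a = refl
  ... | yes refl | no  b≢a  = iSign-coeff₀₁ (off-diagonal-sign b≢a)
  ... | no  _    | yes _    = refl
  ... | no  _    | no  _    = refl

  product-coeff₁₀ : ∀ a b c → prodCoeff (D a c) (D b c) x₁ x₀ ≡ 0ℤ +i (𝟙 (b ≟ c) * S a c)
  product-coeff₁₀ a b c with a ≟ c | b ≟ c
  ... | yes refl | yes refl rewrite hollow a = refl
  ... | yes _    | no  _    = refl
  ... | no  a≢b  | yes refl = iSign-coeff₁₀ (off-diagonal-sign a≢b)
  ... | no  _    | no  _    = refl

  coeff₀₀ : ∀ a b → C D a b x₀ x₀ ≡ δ a b 1
  coeff₀₀ a b = begin
    C D a b x₀ x₀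
      ≡⟨ Σᵍ-split n (product-coeff₀₀ a b) ⟩
    (∑[ c < n ] (𝟙 (a ≟ c) * 𝟙 (b ≟ c))) +i (∑[ c < n ] 0ℤ)
      ≡⟨ cong₂ _+i_ (sum-𝟙-≡-* a (λ c → 𝟙 (b ≟ c))) (sum-replicate-zero n) ⟩
    𝟙 (b ≟ a) +i 0ℤ
      ≡⟨ cong (_+i 0ℤ) (trans (𝟙-sym Fin.≡-isDecEquivalence b a) (sym (ℤ.*-identityˡ _))) ⟩
    (1ℤ * 𝟙 (a ≟ b)) +i 0ℤ
      ≡⟨ δ≡𝟙 a b 1 ⟨
    δ a b 1 ∎

  coeff₁₁ : ∀ a b → C D a b x₁ x₁ ≡ δ a b k
  coeff₁₁ a b = begin
    C D a b x₁ x₁                                    ≡⟨ Σᵍ-split n (product-coeff₁₁ a b) ⟩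
    (∑[ c < n ] (S a c * S b c)) +i (∑[ c < n ] 0ℤ)  ≡⟨ cong₂ _+i_ (gram a b) (sum-replicate-zero n) ⟩
    (+ k * 𝟙 (a ≟ b)) +i 0ℤ                          ≡⟨ δ≡𝟙 a b k ⟨
    δ a b k                                          ∎

  cross-coeffs : ∀ a b → C D a b x₀ x₁ +ᵍ C D a b x₁ x₀ ≡ 0ᵍ
  cross-coeffs a b = begin
    C D a b x₀ x₁ +ᵍ C D a b x₁ x₀
      ≡⟨ cong₂ _+ᵍ_ (Σᵍ-split n (product-coeff₀₁ a b)) (Σᵍ-split n (product-coeff₁₀ a b)) ⟩
    ((∑[ c < n ] 0ℤ) +i (∑[ c < n ] (𝟙 (a ≟ c) * - S b c))) +ᵍ
    ((∑[ c < n ] 0ℤ) +i (∑[ c < n ] (𝟙 (b ≟ c) * S a c)))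
      ≡⟨ cong₂ (λ r t → (r + r) +i t) (sum-replicate-zero n)
               (cong₂ _+_ (sum-𝟙-≡-* a (λ c → - S b c)) (sum-𝟙-≡-* b (S a))) ⟩
    0ℤ +i (- S b a + S a b) ≡⟨ cong (λ t → 0ℤ +i (- t + S a b)) (symmetric b a) ⟩
    0ℤ +i (- S a b + S a b) ≡⟨ cong (0ℤ +i_) (ℤ.+-inverseˡ (S a b)) ⟩
    0ᵍ                      ∎

  isCOD : ∀ (s : Fin 2 → ℕ) → s x₀ ≡ 1 → s x₁ ≡ k → IsCOD n 2 s D
  isCOD s s₀≡1 s₁≡k = diagonal , off-diagonal
    where
    diagonal : ∀ a b ℓ → C D a b ℓ ℓ ≡ δ a b (s ℓ)
    diagonal a b zero       rewrite s₀≡1 = coeff₀₀ a b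
    diagonal a b (suc zero) rewrite s₁≡k = coeff₁₁ a b
    +ᵍ-comm : ∀ u v → u +ᵍ v ≡ v +ᵍ u
    +ᵍ-comm (a +i b) (c +i d) = cong₂ _+i_ (ℤ.+-comm a c) (ℤ.+-comm b d)
    off-diagonal : ∀ a b ℓ m → ℓ ≢ m → C D a b ℓ m +ᵍ C D a b m ℓ ≡ 0ᵍ
    off-diagonal a b zero       zero       ℓ≢m = ⊥-elim (ℓ≢m refl)
    off-diagonal a b zero       (suc zero) _   = cross-coeffs a b
    off-diagonal a b (suc zero) zero       _   = trans (+ᵍ-comm (C D a b x₁ x₀) _) (cross-coeffs a b)
    off-diagonal a b (suc zero) (suc zero) ℓ≢m = ⊥-elim (ℓ≢m refl)

conference⇒COD : ∀ {n k} {S : Fin n → Fin n → ℤ} → IsSymmetricConference n k S →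
                 (s : Fin 2 → ℕ) → s x₀ ≡ 1 → s x₁ ≡ k → COD n 2 s
conference⇒COD conference s s₀≡1 s₁≡k = D , isCOD s s₀≡1 s₁≡k
  where open ConferenceDesign conference

record IsConferenceCore (m : ℕ) (M : Fin m → Fin m → ℤ) : Set where
  field
    isSeidelMatrix : IsSeidelMatrix M
    row-sum        : ∀ x → ∑[ z < m ] M x z ≡ 0ℤ
    gram           : ∀ x y → ∑[ z < m ] (M x z * M y z) ≡ + m * 𝟙 (x ≟ y) - 1ℤ

bordered : ∀ {m} → (Fin m → Fin m → ℤ) → Fin (suc m) → Fin (suc m) → ℤ
bordered M zero    zero    = 0ℤ
bordered M zero    (suc _) = 1ℤ
bordered M (suc _) zero    = 1ℤ
bordered M (suc x) (suc y) = M x y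

core⇒conference : ∀ {m} {M : Fin m → Fin m → ℤ} → IsConferenceCore m M →
                  IsSymmetricConference (suc m) m (bordered M)
core⇒conference {m} {M} core = record
  { isSeidelMatrix = record
    { symmetric         = symmetric′
    ; hollow            = hollow′
    ; off-diagonal-sign = sign′
    }
  ; gram = gram′
  }
  where
  open IsConferenceCore core
  open IsSeidelMatrix isSeidelMatrix

  symmetric′ : ∀ a b → bordered M a b ≡ bordered M b a
  symmetric′ zero    zero    = refl
  symmetric′ zero    (suc _) = refl
  symmetric′ (suc _) zero    = refl
  symmetric′ (suc x) (suc y) = symmetric x y

  hollow′ : ∀ a → bordered M a a ≡ 0ℤ
  hollow′ zero    = refl
  hollow′ (suc x) = hollow x

  sign′ : ∀ {a b} → a ≢ b → IsSign (bordered M a b)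
  sign′ {zero}  {zero}  a≢b = ⊥-elim (a≢b refl)
  sign′ {zero}  {suc _} _   = inj₁ refl
  sign′ {suc _} {zero}  _   = inj₁ refl
  sign′ {suc x} {suc y} a≢b = off-diagonal-sign (a≢b ∘ cong suc)

  gram′ : ∀ a b → ∑[ c < suc m ] (bordered M a c * bordered M b c) ≡ + m * 𝟙 (a ≟ b)
  gram′ zero zero = begin
    0ℤ + ∑[ z < m ] 1ℤ  ≡⟨ ℤ.+-identityˡ _ ⟩
    ∑[ z < m ] 1ℤ       ≡⟨ sum-const m 1ℤ ⟩
    + m * 1ℤ            ∎
  gram′ zero (suc y) = begin
    0ℤ + ∑[ z < m ] (1ℤ * M y z) ≡⟨ ℤ.+-identityˡ _ ⟩
    ∑[ z < m ] (1ℤ * M y z)      ≡⟨ sum-cong-≗ (λ z → ℤ.*-identityˡ (M y z)) ⟩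
    ∑[ z < m ] M y z             ≡⟨ row-sum y ⟩
    0ℤ                           ≡⟨ ℤ.*-zeroʳ (+ m) ⟨
    + m * 0ℤ                     ∎
  gram′ (suc x) zero = begin
    0ℤ + ∑[ z < m ] (M x z * 1ℤ) ≡⟨ ℤ.+-identityˡ _ ⟩
    ∑[ z < m ] (M x z * 1ℤ)      ≡⟨ sum-cong-≗ (λ z → ℤ.*-identityʳ (M x z)) ⟩
    ∑[ z < m ] M x z             ≡⟨ row-sum x ⟩
    0ℤ                           ≡⟨ ℤ.*-zeroʳ (+ m) ⟨
    + m * 0ℤ                     ∎
  gram′ (suc x) (suc y) = begin
    1ℤ + ∑[ z < m ] (M x z * M y z) ≡⟨ cong (_+_ 1ℤ) (gram x y) ⟩
    1ℤ + (+ m * 𝟙 (x ≟ y) - 1ℤ)     ≡⟨ 1+[t-1]≡t (+ m * 𝟙 (x ≟ y)) ⟩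
    + m * 𝟙 (x ≟ y)                 ≡⟨ cong (+ m *_) (𝟙-cong (x ≟ y) (suc x ≟ suc y) (cong suc) Fin.suc-injective) ⟩
    + m * 𝟙 (suc x ≟ suc y)         ∎
    where
    1+[t-1]≡t : ∀ t → 1ℤ + (t - 1ℤ) ≡ t
    1+[t-1]≡t = solve-∀

-- Affine planes

-- An affine plane of order q on the points Fin (q ^ 2), given by its q + 1 parallel classes:
-- x ∼[ L ] y says that x and y lie on a common line of the class L.
record IsAffinePlane (q : ℕ) (_∼[_]_ : Fin (q ^ 2) → Fin (suc q) → Fin (q ^ 2) → Set) : Set where
  field
    isDecEquivalence : ∀ L → IsDecEquivalence (λ x y → x ∼[ L ] y)

  infix 4 _∼?[_]_
  _∼?[_]_ : ∀ x L y → Dec (x ∼[ L ] y)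
  x ∼?[ L ] y = IsDecEquivalence._≟_ (isDecEquivalence L) x y

  field
    line-size    : ∀ L x → ∑[ z < q ^ 2 ] 𝟙 (x ∼?[ L ] z) ≡ + q
    lines-meet   : ∀ {L L′} → L ≢ L′ → ∀ x y →
                   ∑[ z < q ^ 2 ] (𝟙 (x ∼?[ L ] z) * 𝟙 (y ∼?[ L′ ] z)) ≡ 1ℤ
    unique-class : ∀ {x y} → x ≢ y → ∃! _≡_ (λ L → x ∼[ L ] y)

module AffinePlaneCore {q _∼[_]_} (plane : IsAffinePlane q _∼[_]_) (2∤q : ¬ 2 ∣ q) where
  open IsAffinePlane plane

  c : Fin (suc q) → ℤ
  c L = -1ℤ ℤ.^ toℕ L

  sum-c : ∑[ L < suc q ] c L ≡ 0ℤ
  sum-c = sum-alternating-odd q 2∤q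

  c*c : ∀ L → c L * c L ≡ 1ℤ
  c*c L = sign*sign (-1^-sign (toℕ L))

  χ : Fin (suc q) → Fin (q ^ 2) → Fin (q ^ 2) → ℤ
  χ L x y = 𝟙 (x ∼?[ L ] y)

  M : Fin (q ^ 2) → Fin (q ^ 2) → ℤ
  M x y = ∑[ L < suc q ] (c L * χ L x y)

  χ-refl : ∀ L x → χ L x x ≡ 1ℤ
  χ-refl L x = 𝟙-yes (x ∼?[ L ] x) (IsDecEquivalence.refl (isDecEquivalence L))

  M-symmetric : ∀ x y → M x y ≡ M y x
  M-symmetric x y = sum-cong-≗ (λ L → cong (c L *_) (𝟙-sym (isDecEquivalence L) x y))

  M-hollow : ∀ x → M x x ≡ 0ℤ
  M-hollow x = trans (sum-cong-≗ (λ L → trans (cong (c L *_) (χ-refl L x)) (ℤ.*-identityʳ (c L)))) sum-c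

  M-sign : ∀ {x y} → x ≢ y → IsSign (M x y)
  M-sign {x} {y} x≢y with unique-class x≢y
  ... | L₀ , x∼y , unique = subst IsSign (sym M≡c) (-1^-sign (toℕ L₀))
    where
    M≡c : M x y ≡ c L₀
    M≡c = begin
      M x y           ≡⟨ sum-single _ L₀ (λ L L≢L₀ → trans (cong (c L *_) (𝟙-no (x ∼?[ L ] y) (L≢L₀ ∘ sym ∘ unique)))
                                                             (ℤ.*-zeroʳ (c L))) ⟩
      c L₀ * χ L₀ x y ≡⟨ cong (c L₀ *_) (𝟙-yes (x ∼?[ L₀ ] y) x∼y) ⟩
      c L₀ * 1ℤ       ≡⟨ ℤ.*-identityʳ (c L₀) ⟩
      c L₀            ∎

  M-row-sum : ∀ x → ∑[ z < q ^ 2 ] M x z ≡ 0ℤ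
  M-row-sum x = begin
    ∑[ z < q ^ 2 ] ∑[ L < suc q ] (c L * χ L x z) ≡⟨ ∑-comm (λ z L → c L * χ L x z) ⟩
    ∑[ L < suc q ] ∑[ z < q ^ 2 ] (c L * χ L x z) ≡⟨ sum-cong-≗ (λ L → sym (*-distribˡ-sum (c L) (χ L x))) ⟩
    ∑[ L < suc q ] (c L * ∑[ z < q ^ 2 ] χ L x z)  ≡⟨ sum-cong-≗ (λ L → cong (c L *_) (line-size L x)) ⟩
    ∑[ L < suc q ] (c L * + q)                     ≡⟨ *-distribʳ-sum (+ q) c ⟨
    (∑[ L < suc q ] c L) * + q                     ≡⟨ cong (_* + q) sum-c ⟩
    0ℤ                                             ∎

  meet : Fin (suc q) → Fin (suc q) → Fin (q ^ 2) → Fin (q ^ 2) → ℤ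
  meet L L′ x y = ∑[ z < q ^ 2 ] (χ L x z * χ L′ y z)

  meet-same : ∀ L x y → meet L L x y ≡ + q * χ L x y
  meet-same L x y = begin
    meet L L x y                     ≡⟨ sum-𝟙-product (isDecEquivalence L) x y (λ z → z) ⟩
    χ L x y * ∑[ z < q ^ 2 ] χ L x z ≡⟨ cong (χ L x y *_) (line-size L x) ⟩
    χ L x y * + q                    ≡⟨ ℤ.*-comm (χ L x y) (+ q) ⟩
    + q * χ L x y                    ∎

  -- Lines of distinct classes meet once and the weights sum to zero, so only L′ = L contributes.
  sum-c*meet : ∀ L x y → ∑[ L′ < suc q ] (c L′ * meet L L′ x y) ≡ c L * (+ q * χ L x y - 1ℤ)
  sum-c*meet L x y = begin
    ∑[ L′ < suc q ] (c L′ * meet L L′ x y)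
      ≡⟨ sum-cong-≗ (λ L′ → split (c L′) (meet L L′ x y)) ⟩
    ∑[ L′ < suc q ] (c L′ + c L′ * (meet L L′ x y - 1ℤ))
      ≡⟨ ∑-distrib-+ c (λ L′ → c L′ * (meet L L′ x y - 1ℤ)) ⟩
    ∑[ L′ < suc q ] c L′ + ∑[ L′ < suc q ] (c L′ * (meet L L′ x y - 1ℤ))
      ≡⟨ cong₂ _+_ sum-c (sum-single _ L off-diagonal) ⟩
    0ℤ + c L * (meet L L x y - 1ℤ)
      ≡⟨ ℤ.+-identityˡ _ ⟩
    c L * (meet L L x y - 1ℤ)
      ≡⟨ cong (λ t → c L * (t - 1ℤ)) (meet-same L x y) ⟩
    c L * (+ q * χ L x y - 1ℤ) ∎
    where
    split : ∀ a t → a * t ≡ a + a * (t - 1ℤ)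
    split = solve-∀
    off-diagonal : ∀ L′ → L′ ≢ L → c L′ * (meet L L′ x y - 1ℤ) ≡ 0ℤ
    off-diagonal L′ L′≢L rewrite lines-meet (L′≢L ∘ sym) x y = ℤ.*-zeroʳ (c L′)

  sum-χ : ∀ x y → ∑[ L < suc q ] χ L x y ≡ 1ℤ + + q * 𝟙 (x ≟ y)
  sum-χ x y with x ≟ y
  ... | yes refl = trans (sum-cong-≗ (λ L → χ-refl L x)) (trans (sum-const (suc q) 1ℤ) (ℤ.suc-* (+ q) 1ℤ))
  ... | no  x≢y  = trans (sum-𝟙-∃! (λ L → x ∼?[ L ] y) (unique-class x≢y)) (cong (_+_ 1ℤ) (sym (ℤ.*-zeroʳ (+ q))))

  M-gram-by-classes : ∀ x y → ∑[ z < q ^ 2 ] (M x z * M y z) ≡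
                      ∑[ L < suc q ] ∑[ L′ < suc q ] (c L * (c L′ * meet L L′ x y))
  M-gram-by-classes x y = begin
    ∑[ z < q ^ 2 ] (M x z * M y z)
      ≡⟨ sum-cong-≗ (λ z → sum-*-sum (λ L → c L * χ L x z) (λ L′ → c L′ * χ L′ y z)) ⟩
    ∑[ z < q ^ 2 ] ∑[ L < suc q ] ∑[ L′ < suc q ] ((c L * χ L x z) * (c L′ * χ L′ y z))
      ≡⟨ ∑-comm (λ z L → ∑[ L′ < suc q ] ((c L * χ L x z) * (c L′ * χ L′ y z))) ⟩
    ∑[ L < suc q ] ∑[ z < q ^ 2 ] ∑[ L′ < suc q ] ((c L * χ L x z) * (c L′ * χ L′ y z))
      ≡⟨ sum-cong-≗ (λ L → trans (∑-comm (λ z L′ → (c L * χ L x z) * (c L′ * χ L′ y z)))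
                                 (sum-cong-≗ (λ L′ → pull-out L L′))) ⟩
    ∑[ L < suc q ] ∑[ L′ < suc q ] (c L * (c L′ * meet L L′ x y)) ∎
    where
    regroup : ∀ a u b v → (a * u) * (b * v) ≡ a * (b * (u * v))
    regroup = solve-∀
    pull-out : ∀ L L′ → ∑[ z < q ^ 2 ] ((c L * χ L x z) * (c L′ * χ L′ y z)) ≡ c L * (c L′ * meet L L′ x y)
    pull-out L L′ = begin
      ∑[ z < q ^ 2 ] ((c L * χ L x z) * (c L′ * χ L′ y z))
        ≡⟨ sum-cong-≗ (λ z → regroup (c L) (χ L x z) (c L′) (χ L′ y z)) ⟩
      ∑[ z < q ^ 2 ] (c L * (c L′ * (χ L x z * χ L′ y z)))
        ≡⟨ *-distribˡ-sum (c L) (λ z → c L′ * (χ L x z * χ L′ y z)) ⟨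
      c L * ∑[ z < q ^ 2 ] (c L′ * (χ L x z * χ L′ y z))
        ≡⟨ cong (c L *_) (sym (*-distribˡ-sum (c L′) (λ z → χ L x z * χ L′ y z))) ⟩
      c L * (c L′ * meet L L′ x y) ∎

  M-gram : ∀ x y → ∑[ z < q ^ 2 ] (M x z * M y z) ≡ + (q ^ 2) * 𝟙 (x ≟ y) - 1ℤ
  M-gram x y = begin
    ∑[ z < q ^ 2 ] (M x z * M y z)
      ≡⟨ M-gram-by-classes x y ⟩
    ∑[ L < suc q ] ∑[ L′ < suc q ] (c L * (c L′ * meet L L′ x y))
      ≡⟨ sum-cong-≗ (λ L → trans (sym (*-distribˡ-sum (c L) (λ L′ → c L′ * meet L L′ x y)))
                                 (cong (c L *_) (sum-c*meet L x y))) ⟩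
    ∑[ L < suc q ] (c L * (c L * (+ q * χ L x y - 1ℤ)))
      ≡⟨ sum-cong-≗ (λ L → cancel-sign (c L) (+ q * χ L x y - 1ℤ) (c*c L)) ⟩
    ∑[ L < suc q ] (+ q * χ L x y + -1ℤ)
      ≡⟨ ∑-distrib-+ (λ L → + q * χ L x y) (λ _ → -1ℤ) ⟩
    ∑[ L < suc q ] (+ q * χ L x y) + ∑[ L < suc q ] -1ℤ
      ≡⟨ cong₂ _+_ (trans (sym (*-distribˡ-sum (+ q) (λ L → χ L x y))) (cong (+ q *_) (sum-χ x y)))
                   (sum-const (suc q) -1ℤ) ⟩
    + q * (1ℤ + + q * 𝟙 (x ≟ y)) + (1ℤ + + q) * -1ℤ
      ≡⟨ gram-arithmetic (+ q) (𝟙 (x ≟ y)) ⟩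
    + q * + q * 𝟙 (x ≟ y) - 1ℤ
      ≡⟨ cong (λ t → t * 𝟙 (x ≟ y) - 1ℤ) +q^2≡+q*+q ⟨
    + (q ^ 2) * 𝟙 (x ≟ y) - 1ℤ ∎
    where
    cancel-sign : ∀ a t → a * a ≡ 1ℤ → a * (a * t) ≡ t
    cancel-sign a t a*a≡1 = trans (sym (ℤ.*-assoc a a t)) (trans (cong (_* t) a*a≡1) (ℤ.*-identityˡ t))
    gram-arithmetic : ∀ q e → q * (1ℤ + q * e) + (1ℤ + q) * -1ℤ ≡ q * q * e - 1ℤ
    gram-arithmetic = solve-∀
    +q^2≡+q*+q : + (q ^ 2) ≡ + q * + q
    +q^2≡+q*+q = trans (cong (λ n → + (q ℕ.* n)) (ℕ.*-identityʳ q)) (ℤ.pos-* q q)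

  isConferenceCore : IsConferenceCore (q ^ 2) M
  isConferenceCore = record
    { isSeidelMatrix = record
      { symmetric         = M-symmetric
      ; hollow            = M-hollow
      ; off-diagonal-sign = M-sign
      }
    ; row-sum = M-row-sum
    ; gram    = M-gram
    }

-- Congruences modulo a prime

infix 4 _≡_mod_ _≡?_mod_

_≡_mod_ : ℤ → ℤ → ℕ → Set
_≡_mod_ x y m = + m ∣ℤ x - y

_≡?_mod_ : ∀ x y m → Dec (x ≡ y mod m)
_≡?_mod_ x y m = + m ∣ℤ? x - y

≡-mod-refl : ∀ {m} x → x ≡ x mod m
≡-mod-refl x = subst (_ ∣ℤ_) (sym (ℤ.+-inverseʳ x)) (divides 0ℤ refl)

≡-mod-sym : ∀ {m} x y → x ≡ y mod m → y ≡ x mod m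
≡-mod-sym x y = subst (_ ∣ℤ_) (-[x-y]≡y-x x y) ∘ ∣m⇒∣-m
  where
  -[x-y]≡y-x : ∀ x y → - (x - y) ≡ y - x
  -[x-y]≡y-x = solve-∀

≡-mod-trans : ∀ {m} x y z → x ≡ y mod m → y ≡ z mod m → x ≡ z mod m
≡-mod-trans x y z x≡y y≡z = subst (_ ∣ℤ_) ([x-y]+[y-z]≡x-z x y z) (∣m∣n⇒∣m+n x≡y y≡z)
  where
  [x-y]+[y-z]≡x-z : ∀ x y z → (x - y) + (y - z) ≡ x - z
  [x-y]+[y-z]≡x-z = solve-∀

≡-mod-isDecEquivalence : ∀ m → IsDecEquivalence (λ x y → x ≡ y mod m)
≡-mod-isDecEquivalence m = record
  { isEquivalence = record
    { refl  = λ {x} → ≡-mod-refl x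
    ; sym   = λ {x} {y} → ≡-mod-sym x y
    ; trans = λ {x} {y} {z} → ≡-mod-trans x y z
    }
  ; _≟_ = λ x y → x ≡? y mod m
  }

≡0-mod⇒≡-mod : ∀ m x y → x - y ≡ 0ℤ mod m → x ≡ y mod m
≡0-mod⇒≡-mod m x y = subst (+ m ∣ℤ_) (ℤ.+-identityʳ (x - y))

module ResidueField (p : ℕ) (p-prime : Prime p) where

  instance
    p≢0 : NonZero p
    p≢0 = prime⇒nonZero p-prime

  ⟦_⟧ : Fin p → ℤ
  ⟦ t ⟧ = + toℕ t

  residue : ∀ v → ∃ λ t → v ≡ ⟦ t ⟧ mod p
  residue v = fromℕ< r<p , divides (v ℤ./ℕ p) (begin
    v - ⟦ fromℕ< r<p ⟧               ≡⟨ cong (λ r → v - + r) (Fin.toℕ-fromℕ< r<p) ⟩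
    v - + (v ℤ.%ℕ p)                 ≡⟨ cong (_- + (v ℤ.%ℕ p)) (ℤ.a≡a%ℕn+[a/ℕn]*n v p) ⟩
    (+ (v ℤ.%ℕ p) + (v ℤ./ℕ p) * + p) - + (v ℤ.%ℕ p) ≡⟨ [r+k]-r≡k (+ (v ℤ.%ℕ p)) ((v ℤ./ℕ p) * + p) ⟩
    (v ℤ./ℕ p) * + p                 ∎)
    where
    r<p = ℤ.n%ℕd<d v p
    [r+k]-r≡k : ∀ r k → (r + k) - r ≡ k
    [r+k]-r≡k = solve-∀

  ⟦⟧-injective : ∀ {s t} → ⟦ s ⟧ ≡ ⟦ t ⟧ mod p → s ≡ t
  ⟦⟧-injective {s} {t} s≡t = Fin.toℕ-injective (ℤ.+-injective (ℤ.i-j≡0⇒i≡j ⟦ s ⟧ ⟦ t ⟧ (ℤ.∣i∣≡0⇒i≡0 ∣s-t∣≡0)))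
    where
    multiple<p⇒≡0 : ∀ {n} → p ∣ n → n ℕ.< p → n ≡ 0
    multiple<p⇒≡0 {zero}  _   _   = refl
    multiple<p⇒≡0 {suc n} p∣n n<p = contradiction p∣n (ℕ.>⇒∤ n<p)
    ∣s-t∣<p : ∣ ⟦ s ⟧ - ⟦ t ⟧ ∣ ℕ.< p
    ∣s-t∣<p = subst (ℕ._< p) (cong ∣_∣ (sym (ℤ.[+m]-[+n]≡m⊖n (toℕ s) (toℕ t))))
                (ℕ.≤-<-trans (ℤ.∣m⊝n∣≤m⊔n (toℕ s) (toℕ t)) (ℕ.⊔-pres-<m (Fin.toℕ<n s) (Fin.toℕ<n t)))
    ∣s-t∣≡0 : ∣ ⟦ s ⟧ - ⟦ t ⟧ ∣ ≡ 0
    ∣s-t∣≡0 = multiple<p⇒≡0 (∣⇒∣ᵤ s≡t) ∣s-t∣<p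

  coprime-to-p : ∀ {α} → ¬ + p ∣ℤ α → Coprime ∣ α ∣ p
  coprime-to-p p∤α {d} (d∣α , d∣p) with prime⇒irreducible p-prime d∣p
  ... | inj₁ d≡1 = d≡1
  ... | inj₂ refl = contradiction (∣ᵤ⇒∣ d∣α) p∤α

  abs-inverse : ∀ {α} → ¬ + p ∣ℤ α → ∃ λ u → + ∣ α ∣ * u ≡ 1ℤ mod p
  abs-inverse {α} p∤α with coprime-Bézout (coprime-to-p p∤α)
  ... | Bézout.+- x y 1+yp≡xα = + x , divides (+ y) (begin
    + ∣ α ∣ * + x - 1ℤ      ≡⟨ cong (_- 1ℤ) (trans (ℤ.*-comm (+ ∣ α ∣) (+ x)) (sym (ℤ.pos-* x ∣ α ∣))) ⟩
    + (x ℕ.* ∣ α ∣) - 1ℤ    ≡⟨ cong (λ n → + n - 1ℤ) (sym 1+yp≡xα) ⟩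
    (1ℤ + + (y ℕ.* p)) - 1ℤ ≡⟨ [1+k]-1≡k (+ (y ℕ.* p)) ⟩
    + (y ℕ.* p)             ≡⟨ ℤ.pos-* y p ⟩
    + y * + p               ∎)
    where
    [1+k]-1≡k : ∀ k → (1ℤ + k) - 1ℤ ≡ k
    [1+k]-1≡k = solve-∀
  ... | Bézout.-+ x y 1+xα≡yp = - + x , divides (- + y) (begin
    + ∣ α ∣ * - + x - 1ℤ      ≡⟨ a*-b-1≡-[1+b*a] (+ ∣ α ∣) (+ x) ⟩
    - (1ℤ + + x * + ∣ α ∣)    ≡⟨ cong (λ t → - (1ℤ + t)) (sym (ℤ.pos-* x ∣ α ∣)) ⟩
    - + (1 ℕ.+ x ℕ.* ∣ α ∣)   ≡⟨ cong (-_ ∘ +_) 1+xα≡yp ⟩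
    - + (y ℕ.* p)             ≡⟨ cong -_ (ℤ.pos-* y p) ⟩
    - (+ y * + p)             ≡⟨ ℤ.neg-distribˡ-* (+ y) (+ p) ⟩
    - + y * + p               ∎)
    where
    a*-b-1≡-[1+b*a] : ∀ a b → a * - b - 1ℤ ≡ - (1ℤ + b * a)
    a*-b-1≡-[1+b*a] = solve-∀

  inverse : ∀ {α} → ¬ α ≡ 0ℤ mod p → ∃ λ u → α * u ≡ 1ℤ mod p
  inverse {α} α≢0 with abs-inverse (α≢0 ∘ subst (+ p ∣ℤ_) (sym (ℤ.+-identityʳ α))) | ℤ.+∣i∣≡i⊎+∣i∣≡-i α
  ... | u , ∣α∣u≡1 | inj₁ ∣α∣≡α  = u , subst (λ a → a * u ≡ 1ℤ mod p) ∣α∣≡α ∣α∣u≡1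
  ... | u , ∣α∣u≡1 | inj₂ ∣α∣≡-α = - u , subst (λ a → + p ∣ℤ a - 1ℤ) -α*u≡α*-u
                                         (subst (λ a → a * u ≡ 1ℤ mod p) ∣α∣≡-α ∣α∣u≡1)
    where
    -α*u≡α*-u : - α * u ≡ α * - u
    -α*u≡α*-u = trans (sym (ℤ.neg-distribˡ-* α u)) (ℤ.neg-distribʳ-* α u)

  linear-congruence : ∀ {α} → ¬ α ≡ 0ℤ mod p → ∀ β → ∃! _≡_ (λ t → α * ⟦ t ⟧ ≡ β mod p)
  linear-congruence {α} α≢0 β with inverse {α} α≢0
  ... | u , αu≡1 with residue (β * u)
  ...   | t , βu≡t = t , αt≡β , unique
    where
    αt≡β : α * ⟦ t ⟧ ≡ β mod p
    αt≡β = subst (+ p ∣ℤ_) (sym (solution α β u ⟦ t ⟧))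
             (∣m∣n⇒∣m+n (∣n⇒∣m*n (- α) βu≡t) (∣n⇒∣m*n β αu≡1))
      where
      solution : ∀ α β u t → α * t - β ≡ - α * (β * u - t) + β * (α * u - 1ℤ)
      solution = solve-∀
    unique : ∀ {s} → α * ⟦ s ⟧ ≡ β mod p → t ≡ s
    unique {s} αs≡β = ⟦⟧-injective (subst (+ p ∣ℤ_) (sym (cancellation α β u ⟦ t ⟧ ⟦ s ⟧))
      (∣m∣n⇒∣m+n (∣n⇒∣m*n u (∣m∣n⇒∣m+n αt≡β (∣m⇒∣-m αs≡β)))
                 (∣m⇒∣-m (∣n⇒∣m*n (⟦ t ⟧ - ⟦ s ⟧) αu≡1))))
      where
      cancellation : ∀ α β u t s → t - s ≡ u * ((α * t - β) + - (α * s - β)) + - ((t - s) * (α * u - 1ℤ))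
      cancellation = solve-∀

  sum-linear-congruence : ∀ {α} → ¬ α ≡ 0ℤ mod p → ∀ β → ∑[ t < p ] 𝟙 (α * ⟦ t ⟧ ≡? β mod p) ≡ 1ℤ
  sum-linear-congruence {α} α≢0 β = sum-𝟙-∃! (λ t → α * ⟦ t ⟧ ≡? β mod p) (linear-congruence {α} α≢0 β)

  sum-residue : ∀ v → ∑[ t < p ] 𝟙 (v ≡? ⟦ t ⟧ mod p) ≡ 1ℤ
  sum-residue v with residue v
  ... | t , v≡t = sum-𝟙-∃! (λ s → v ≡? ⟦ s ⟧ mod p)
                    (t , v≡t , λ {s} v≡s → ⟦⟧-injective (≡-mod-trans ⟦ t ⟧ v ⟦ s ⟧ (≡-mod-sym v ⟦ t ⟧ v≡t) v≡s))

-- The affine plane over ℤ/p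

module AffinePlaneModP (p : ℕ) (p-prime : Prime p) where
  open ResidueField p p-prime

  Point : Set
  Point = Fin p × Fin p

  -- class zero: the vertical lines a = const; class suc s: the lines b - s a = const of slope s
  level : Fin (suc p) → Point → ℤ
  level zero    (a , b) = ⟦ a ⟧
  level (suc s) (a , b) = ⟦ b ⟧ - ⟦ s ⟧ * ⟦ a ⟧

  χ : Fin (suc p) → Point → Point → ℤ
  χ L x y = 𝟙 (level L x ≡? level L y mod p)

  𝟙-mod-cong : ∀ {e e′} → e ≡ e′ → 𝟙 (+ p ∣ℤ? e) ≡ 𝟙 (+ p ∣ℤ? e′)
  𝟙-mod-cong = cong (λ e → 𝟙 (+ p ∣ℤ? e))

  u-[d-w]≡[u+w]-d : ∀ u d w → u - (d - w) ≡ (u + w) - d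
  u-[d-w]≡[u+w]-d = solve-∀

  sum-shifted-residue : ∀ u w → ∑[ d < p ] 𝟙 (u ≡? ⟦ d ⟧ - w mod p) ≡ 1ℤ
  sum-shifted-residue u w =
    trans (sum-cong-≗ (λ d → 𝟙-mod-cong (u-[d-w]≡[u+w]-d u ⟦ d ⟧ w))) (sum-residue (u + w))

  line-size : ∀ L x → ∑[ c < p ] ∑[ d < p ] χ L x (c , d) ≡ + p
  line-size zero (a , b) = begin
    ∑[ c < p ] ∑[ d < p ] 𝟙 (⟦ a ⟧ ≡? ⟦ c ⟧ mod p)  ≡⟨ sum-cong-≗ (λ c → sum-const p (𝟙 (⟦ a ⟧ ≡? ⟦ c ⟧ mod p))) ⟩
    ∑[ c < p ] (+ p * 𝟙 (⟦ a ⟧ ≡? ⟦ c ⟧ mod p))     ≡⟨ *-distribˡ-sum (+ p) (λ c → 𝟙 (⟦ a ⟧ ≡? ⟦ c ⟧ mod p)) ⟨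
    + p * ∑[ c < p ] 𝟙 (⟦ a ⟧ ≡? ⟦ c ⟧ mod p)       ≡⟨ cong (+ p *_) (sum-residue ⟦ a ⟧) ⟩
    + p * 1ℤ                                        ≡⟨ ℤ.*-identityʳ (+ p) ⟩
    + p                                             ∎
  line-size (suc s) x = begin
    ∑[ c < p ] ∑[ d < p ] 𝟙 (level (suc s) x ≡? ⟦ d ⟧ - ⟦ s ⟧ * ⟦ c ⟧ mod p)
      ≡⟨ sum-cong-≗ (λ c → sum-shifted-residue (level (suc s) x) (⟦ s ⟧ * ⟦ c ⟧)) ⟩
    ∑[ c < p ] 1ℤ  ≡⟨ sum-const p 1ℤ ⟩
    + p * 1ℤ       ≡⟨ ℤ.*-identityʳ (+ p) ⟩
    + p            ∎

  vertical-meets-slope : ∀ r x y → ∑[ c < p ] ∑[ d < p ] (χ zero x (c , d) * χ (suc r) y (c , d)) ≡ 1ℤ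
  vertical-meets-slope r (a , b) y = begin
    ∑[ c < p ] ∑[ d < p ] (𝟙 (⟦ a ⟧ ≡? ⟦ c ⟧ mod p) * 𝟙 (v ≡? ⟦ d ⟧ - ⟦ r ⟧ * ⟦ c ⟧ mod p))
      ≡⟨ sum-cong-≗ (λ c → *-distribˡ-sum (𝟙 (⟦ a ⟧ ≡? ⟦ c ⟧ mod p)) (λ d → 𝟙 (v ≡? ⟦ d ⟧ - ⟦ r ⟧ * ⟦ c ⟧ mod p))) ⟨
    ∑[ c < p ] (𝟙 (⟦ a ⟧ ≡? ⟦ c ⟧ mod p) * ∑[ d < p ] 𝟙 (v ≡? ⟦ d ⟧ - ⟦ r ⟧ * ⟦ c ⟧ mod p))
      ≡⟨ sum-cong-≗ (λ c → cong (𝟙 (⟦ a ⟧ ≡? ⟦ c ⟧ mod p) *_) (sum-shifted-residue v (⟦ r ⟧ * ⟦ c ⟧))) ⟩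
    ∑[ c < p ] (𝟙 (⟦ a ⟧ ≡? ⟦ c ⟧ mod p) * 1ℤ)
      ≡⟨ sum-cong-≗ (λ c → ℤ.*-identityʳ (𝟙 (⟦ a ⟧ ≡? ⟦ c ⟧ mod p))) ⟩
    ∑[ c < p ] 𝟙 (⟦ a ⟧ ≡? ⟦ c ⟧ mod p)
      ≡⟨ sum-residue ⟦ a ⟧ ⟩
    1ℤ ∎
    where v = level (suc r) y

  slopes-meet : ∀ {s r} → s ≢ r → ∀ x y →
                ∑[ c < p ] ∑[ d < p ] (χ (suc s) x (c , d) * χ (suc r) y (c , d)) ≡ 1ℤ
  slopes-meet {s} {r} s≢r x y = begin
    ∑[ c < p ] ∑[ d < p ] (𝟙 (u ≡? ⟦ d ⟧ - ⟦ s ⟧ * ⟦ c ⟧ mod p) * 𝟙 (v ≡? ⟦ d ⟧ - ⟦ r ⟧ * ⟦ c ⟧ mod p))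
      ≡⟨ sum-cong-≗ (λ c → sum-cong-≗ (λ d → cong₂ _*_ (𝟙-mod-cong (u-[d-w]≡[u+w]-d u ⟦ d ⟧ (⟦ s ⟧ * ⟦ c ⟧)))
                                                       (𝟙-mod-cong (u-[d-w]≡[u+w]-d v ⟦ d ⟧ (⟦ r ⟧ * ⟦ c ⟧))))) ⟩
    ∑[ c < p ] ∑[ d < p ] (𝟙 (u′ c ≡? ⟦ d ⟧ mod p) * 𝟙 (v′ c ≡? ⟦ d ⟧ mod p))
      ≡⟨ sum-cong-≗ (λ c → sum-𝟙-product (≡-mod-isDecEquivalence p) (u′ c) (v′ c) ⟦_⟧) ⟩
    ∑[ c < p ] (𝟙 (u′ c ≡? v′ c mod p) * ∑[ d < p ] 𝟙 (u′ c ≡? ⟦ d ⟧ mod p))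
      ≡⟨ sum-cong-≗ (λ c → trans (cong (𝟙 (u′ c ≡? v′ c mod p) *_) (sum-residue (u′ c))) (ℤ.*-identityʳ _)) ⟩
    ∑[ c < p ] 𝟙 (u′ c ≡? v′ c mod p)
      ≡⟨ sum-cong-≗ (λ c → 𝟙-mod-cong (collect u v ⟦ s ⟧ ⟦ r ⟧ ⟦ c ⟧)) ⟩
    ∑[ c < p ] 𝟙 ((⟦ s ⟧ - ⟦ r ⟧) * ⟦ c ⟧ ≡? v - u mod p)
      ≡⟨ sum-linear-congruence {⟦ s ⟧ - ⟦ r ⟧} s-r≢0 (v - u) ⟩
    1ℤ ∎
    where
    u = level (suc s) x
    v = level (suc r) y
    u′ v′ : Fin p → ℤ
    u′ c = u + ⟦ s ⟧ * ⟦ c ⟧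
    v′ c = v + ⟦ r ⟧ * ⟦ c ⟧
    collect : ∀ u v s r c → (u + s * c) - (v + r * c) ≡ (s - r) * c - (v - u)
    collect = solve-∀
    s-r≢0 : ¬ ⟦ s ⟧ - ⟦ r ⟧ ≡ 0ℤ mod p
    s-r≢0 = s≢r ∘ ⟦⟧-injective ∘ ≡0-mod⇒≡-mod p ⟦ s ⟧ ⟦ r ⟧

  lines-meet : ∀ {L L′} → L ≢ L′ → ∀ x y → ∑[ c < p ] ∑[ d < p ] (χ L x (c , d) * χ L′ y (c , d)) ≡ 1ℤ
  lines-meet {zero}  {zero}  L≢L′ _ _ = ⊥-elim (L≢L′ refl)
  lines-meet {zero}  {suc r} _    x y = vertical-meets-slope r x y
  lines-meet {suc s} {zero}  _    x y =
    trans (sum-cong-≗ (λ c → sum-cong-≗ (λ d → ℤ.*-comm (χ (suc s) x (c , d)) (χ zero y (c , d)))))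
          (vertical-meets-slope s y x)
  lines-meet {suc s} {suc r} L≢L′ x y = slopes-meet (L≢L′ ∘ cong suc) x y

  vertical-class : ∀ {a b a′ b′} → (a , b) ≢ (a′ , b′) → ⟦ a ⟧ ≡ ⟦ a′ ⟧ mod p →
                   ∃! _≡_ (λ L → level L (a , b) ≡ level L (a′ , b′) mod p)
  vertical-class {a} {b} {a′} {b′} x≢y a≡a′ = zero , a≡a′ , only-vertical
    where
    recover : ∀ b b′ s a a′ → b - b′ ≡ ((b - s * a) - (b′ - s * a′)) + s * (a - a′)
    recover = solve-∀
    only-vertical : ∀ {L} → level L (a , b) ≡ level L (a′ , b′) mod p → zero ≡ L
    only-vertical {zero}  _        = refl
    only-vertical {suc s} on-slope = ⊥-elim (x≢y (cong₂ _,_ (⟦⟧-injective a≡a′) (⟦⟧-injective b≡b′)))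
      where
      b≡b′ : ⟦ b ⟧ ≡ ⟦ b′ ⟧ mod p
      b≡b′ = subst (+ p ∣ℤ_) (sym (recover ⟦ b ⟧ ⟦ b′ ⟧ ⟦ s ⟧ ⟦ a ⟧ ⟦ a′ ⟧))
                   (∣m∣n⇒∣m+n on-slope (∣n⇒∣m*n ⟦ s ⟧ a≡a′))

  slope-class : ∀ {a b a′ b′} → ¬ ⟦ a ⟧ ≡ ⟦ a′ ⟧ mod p →
                ∃! _≡_ (λ L → level L (a , b) ≡ level L (a′ , b′) mod p)
  slope-class {a} {b} {a′} {b′} a≢a′ = suc s , subst (+ p ∣ℤ_) (sym (slope s)) slope-s , only-slope
    where
    α≢0 : ¬ ⟦ a′ ⟧ - ⟦ a ⟧ ≡ 0ℤ mod p
    α≢0 = a≢a′ ∘ ≡-mod-sym ⟦ a′ ⟧ ⟦ a ⟧ ∘ ≡0-mod⇒≡-mod p ⟦ a′ ⟧ ⟦ a ⟧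
    solution : ∃! _≡_ (λ t → (⟦ a′ ⟧ - ⟦ a ⟧) * ⟦ t ⟧ ≡ ⟦ b′ ⟧ - ⟦ b ⟧ mod p)
    solution = linear-congruence {⟦ a′ ⟧ - ⟦ a ⟧} α≢0 (⟦ b′ ⟧ - ⟦ b ⟧)
    s : Fin p
    s = proj₁ solution
    slope-s : (⟦ a′ ⟧ - ⟦ a ⟧) * ⟦ s ⟧ ≡ ⟦ b′ ⟧ - ⟦ b ⟧ mod p
    slope-s = proj₁ (proj₂ solution)
    slope-identity : ∀ b b′ s a a′ → (b - s * a) - (b′ - s * a′) ≡ (a′ - a) * s - (b′ - b)
    slope-identity = solve-∀
    slope : ∀ t → level (suc t) (a , b) - level (suc t) (a′ , b′) ≡ (⟦ a′ ⟧ - ⟦ a ⟧) * ⟦ t ⟧ - (⟦ b′ ⟧ - ⟦ b ⟧)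
    slope t = slope-identity ⟦ b ⟧ ⟦ b′ ⟧ ⟦ t ⟧ ⟦ a ⟧ ⟦ a′ ⟧
    only-slope : ∀ {L} → level L (a , b) ≡ level L (a′ , b′) mod p → suc s ≡ L
    only-slope {zero}  a≡a′ = ⊥-elim (a≢a′ a≡a′)
    only-slope {suc t} on-t = cong suc (proj₂ (proj₂ solution) (subst (+ p ∣ℤ_) (slope t) on-t))

  unique-class : ∀ {x y} → x ≢ y → ∃! _≡_ (λ L → level L x ≡ level L y mod p)
  unique-class {a , b} {a′ , b′} x≢y with ⟦ a ⟧ ≡? ⟦ a′ ⟧ mod p
  ... | yes a≡a′ = vertical-class x≢y a≡a′
  ... | no  a≢a′ = slope-class a≢a′

  p^2≡p*p : p ^ 2 ≡ p ℕ.* p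
  p^2≡p*p = cong (p ℕ.*_) (ℕ.*-identityʳ p)

  coordinates : Fin (p ^ 2) → Point
  coordinates = remQuot p ∘ cast p^2≡p*p

  coordinates-injective : ∀ {x y} → coordinates x ≡ coordinates y → x ≡ y
  coordinates-injective {x} {y} eq = Fin.toℕ-injective (begin
    toℕ x                 ≡⟨ Fin.toℕ-cast p^2≡p*p x ⟨
    toℕ (cast p^2≡p*p x)  ≡⟨ cong toℕ cast-eq ⟩
    toℕ (cast p^2≡p*p y)  ≡⟨ Fin.toℕ-cast p^2≡p*p y ⟩
    toℕ y                 ∎)
    where
    cast-eq : cast p^2≡p*p x ≡ cast p^2≡p*p y
    cast-eq = trans (sym (Fin.combine-remQuot {p} p (cast p^2≡p*p x)))
                    (trans (cong (uncurry combine) eq) (Fin.combine-remQuot {p} p (cast p^2≡p*p y)))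

  sum-coordinates : ∀ (f : Point → ℤ) → ∑[ z < p ^ 2 ] f (coordinates z) ≡ ∑[ c < p ] ∑[ d < p ] f (c , d)
  sum-coordinates f = begin
    ∑[ z < p ^ 2 ] f (remQuot p (cast p^2≡p*p z))    ≡⟨ sum-cast p^2≡p*p (f ∘ remQuot p) ⟩
    ∑[ z < p ℕ.* p ] f (remQuot p z)                  ≡⟨ sum-combine p (f ∘ remQuot p) ⟩
    ∑[ c < p ] ∑[ d < p ] f (remQuot p (combine c d)) ≡⟨ sum-cong-≗ (λ c → sum-cong-≗ (λ d → cong f (Fin.remQuot-combine c d))) ⟩
    ∑[ c < p ] ∑[ d < p ] f (c , d)                   ∎

  _∼[_]_ : Fin (p ^ 2) → Fin (suc p) → Fin (p ^ 2) → Set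
  x ∼[ L ] y = level L (coordinates x) ≡ level L (coordinates y) mod p

  isAffinePlane : IsAffinePlane p _∼[_]_
  isAffinePlane = record
    { isDecEquivalence = λ L → On.isDecEquivalence (level L ∘ coordinates) (≡-mod-isDecEquivalence p)
    ; line-size        = λ L x → trans (sum-coordinates (χ L (coordinates x))) (line-size L (coordinates x))
    ; lines-meet       = λ {L} {L′} L≢L′ x y →
        trans (sum-coordinates (λ z → χ L (coordinates x) z * χ L′ (coordinates y) z))
              (lines-meet L≢L′ (coordinates x) (coordinates y))
    ; unique-class     = λ x≢y → unique-class (x≢y ∘ coordinates-injective)
    }

lemma4p2 : (p : ℕ) → Prime p → ¬ (2 ∣ p) →
    COD (suc (p ^ 2)) 2 (type1p² p)
lemma4p2 p p-prime 2∤p =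
  conference⇒COD (core⇒conference (AffinePlaneCore.isConferenceCore plane 2∤p)) (type1p² p) refl refl
  where plane = AffinePlaneModP.isAffinePlane p p-prime
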